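{- Let $d\geq 1$ and $2\leq n_1\leq n_2\leq\cdots\leq n_d$ be integers, and let $G=P_{n_1}\times P_{n_2}\times\cdots\times P_{n_d}$. Then $$\sigma_T(G)\leq 2\left(\left\lfloor\tfrac{n_1}{2}\right\rfloor+\left\lfloor\tfrac{n_2}{2}\right\rfloor+\cdots+\left\lfloor\tfrac{n_{d-1}}{2}\right\rfloor\right)+1.$$
   Context: $P_n$ is the path on $n$ vertices and $\times$ is the Cartesian product of graphs: $V(G\times H)=V(G)\times V(H)$, and $(u,v)\sim(u',v')$ iff either $u=u'$ and $vv'\in E(H)$, or $v=v'$ and $uu'\in E(G)$. Thus the vertices of $G$ are vectors $(x_1,\ldots,x_d)$ with $x_i\in\{1,\ldots,n_i\}$, adjacent iff they differ by 1 in exactly one coordinate. For a spanning tree $T$ of a connected graph $G$, $d_T(u,v)$ denotes the distance in $T$, $\sigma_T(G,T):=\max_{uv\in E(G)} d_T(u,v)$, and the tree-stretch of $G$ is $\sigma_T(G):=\min\{\sigma_T(G,T): T \text{ a spanning tree of } G\}$. For $d=1$ the sum in the bound is empty (equal to $0$). -}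

module Defs where

open import Data.Nat using (ℕ; zero; suc; _+_; _*_; _≤_; _<_)
open import Data.Vec using (Vec; []; _∷_)
open import Data.List using (List; []; _∷_; _++_; [_])
open import Data.List.Relation.Unary.Unique.Propositional using (Unique)
open import Data.Product using (_×_; Σ; ∃-syntax)
open import Data.Sum using (_⊎_)
open import Data.Empty using (⊥)
open import Data.Unit using (⊤)
open import Relation.Nullary using (¬_)
open import Relation.Binary.PropositionalEquality using (_≡_)

Vertex : ℕ → Set
Vertex d = Vec ℕ d

InGrid : ∀ {d} → Vec ℕ d → Vertex d → Set
InGrid []       []       = ⊤
InGrid (n ∷ ns) (x ∷ xs) = (1 ≤ x × x ≤ n) × InGrid ns xs

PathAdj : ℕ → ℕ → Set
PathAdj x y = suc x ≡ y ⊎ suc y ≡ x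

DiffOne : ∀ {d} → Vertex d → Vertex d → Set
DiffOne []       []       = ⊥
DiffOne (x ∷ xs) (y ∷ ys) = (PathAdj x y × xs ≡ ys) ⊎ (x ≡ y × DiffOne xs ys)

GridAdj : ∀ {d} → Vec ℕ d → Vertex d → Vertex d → Set
GridAdj ns u v = InGrid ns u × InGrid ns v × DiffOne u v

data Walk {V : Set} (E : V → V → Set) : ℕ → V → V → Set where
  here  : ∀ {u} → Walk E zero u u
  step  : ∀ {k u w v} → E u w → Walk E k w v → Walk E (suc k) u v

Chain : {V : Set} → (V → V → Set) → List V → Set
Chain E []            = ⊤
Chain E (x ∷ [])      = ⊤
Chain E (x ∷ y ∷ xs)  = E x y × Chain E (y ∷ xs)

IsCycle : {V : Set} → (V → V → Set) → List V → Set
IsCycle E (x ∷ y ∷ z ∷ rest) =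
  Unique (x ∷ y ∷ z ∷ rest) × Chain E ((x ∷ y ∷ z ∷ rest) ++ [ x ])
IsCycle E _ = ⊥

record IsSpanningTree {d : ℕ} (ns : Vec ℕ d) (T : Vertex d → Vertex d → Set) : Set₁ where
  field
    subgraph  : ∀ u v → T u v → GridAdj ns u v
    symmetric : ∀ u v → T u v → T v u
    connected : ∀ u v → InGrid ns u → InGrid ns v → ∃[ k ] Walk T k u v
    acyclic   : ∀ (cs : List (Vertex d)) → ¬ IsCycle T cs

DistLe : ∀ {d} → (Vertex d → Vertex d → Set) → Vertex d → Vertex d → ℕ → Set
DistLe T u v k = ∃[ m ] (m ≤ k × Walk T m u v)

StretchLe : ∀ {d} → Vec ℕ d → (Vertex d → Vertex d → Set) → ℕ → Set
StretchLe ns T k = ∀ u v → GridAdj ns u v → DistLe T u v k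

TreeStretchLe : ∀ {d} → Vec ℕ d → ℕ → Set₁
TreeStretchLe {d} ns k =
  Σ (Vertex d → Vertex d → Set) λ T → IsSpanningTree ns T × StretchLe ns T k

module Submission where

-- Write c_i = n_i ∸ ⌊n_i/2⌋ for the centre of the i-th path: every value
-- in 1..n_i is within ⌊n_i/2⌋ steps of it.  The spanning tree is built
-- recursively, coordinate by coordinate: through every vertex runs its
-- line in direction 1, oriented towards the centre c_1 (a "comb"), and the
-- teeth meet in the slice x_1 = c_1, which carries the same tree for
-- P_{n_2} × ... × P_{n_d}.  The root is (c_1,...,c_d).
--
-- * It is a tree: each vertex has at most one parent and the parent is
--   strictly closer to the root in the rank Σ |x_i - c_i|.  A general lemma
--   (module ParentForest) shows that such a parent relation has no cycles.
-- * It is connected: every vertex walks to the root.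
-- * Stretch: an edge in direction 1 is a tree edge; an edge (a,x) ~ (a,y)
--   in a later direction is bridged by walking from a to c_1 (≤ ⌊n_1/2⌋
--   steps), using the slice tree from x to y, and walking back.  Induction
--   on d gives the bound 2(⌊n_1/2⌋ + ... + ⌊n_{d-1}/2⌋) + 1.

open import Defs
open import Data.Nat using (ℕ; suc; _+_; _*_; _≤_; _/_)
open import Data.Fin using (Fin) renaming (_≤_ to _≤ᶠ_)
open import Data.Vec using (Vec; lookup; init; map; sum)

open import Data.Nat using (zero; _∸_; _<_; ∣_-_∣; z≤n; s≤s; s≤s⁻¹; _≤?_)
open import Data.Nat.Properties
open import Data.Nat.DivMod using (_%_; m/n≤m; m/n<m; m%n<n; m≡m%n+[m/n]*n)
open import Data.Nat.Tactic.RingSolver using (solve-∀)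
open import Data.Vec using ([]; _∷_)
open import Data.List using (List; []; _∷_; _++_; [_])
open import Data.List.Relation.Unary.All as All using (All; _∷_)
open import Data.List.Relation.Unary.Any using (here; there)
open import Data.List.Relation.Unary.AllPairs using (_∷_)
open import Data.List.Relation.Unary.Unique.Propositional using (Unique)
open import Data.Product using (_×_; _,_; proj₁; proj₂; ∃-syntax)
open import Data.Sum using (_⊎_; inj₁; inj₂; swap) renaming (map to ⊎-map)
open import Data.Empty using (⊥; ⊥-elim)
open import Data.Unit using (⊤; tt)
open import Function using (flip)
open import Relation.Nullary using (¬_; yes; no)
open import Relation.Binary.PropositionalEquality
  using (_≡_; _≢_; refl; sym; trans; cong₂; subst)

_++ʷ_ : ∀ {V : Set} {E : V → V → Set} {k m u v w}
      → Walk E k u v → Walk E m v w → Walk E (k + m) u w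
here     ++ʷ q = q
step e p ++ʷ q = step e (p ++ʷ q)

mapʷ : ∀ {V W : Set} {E : V → V → Set} {F : W → W → Set} (f : V → W)
     → (∀ {x y} → E x y → F (f x) (f y))
     → ∀ {k u v} → Walk E k u v → Walk F k (f u) (f v)
mapʷ f g here       = here
mapʷ f g (step e p) = step (g e) (mapʷ f g p)

snocʷ : ∀ {V : Set} {E : V → V → Set} {k u v w}
      → Walk E k u v → E v w → Walk E (suc k) u w
snocʷ here       e' = step e' here
snocʷ (step e p) e' = step e (snocʷ p e')

reverseʷ : ∀ {V : Set} {E : V → V → Set} → (∀ {u v} → E u v → E v u)
         → ∀ {k u v} → Walk E k u v → Walk E k v u
reverseʷ E-sym here       = here
reverseʷ E-sym (step e p) = snocʷ (reverseʷ E-sym p) (E-sym e)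

-- Along a walk that never immediately backtracks, once a step goes
-- from parent to child every later step does too (the only parent of the
-- current vertex is the one just left).  A cycle x, y, ..., w, x is such a
-- closed walk.  If its first step leads away from the root, the rank rises
-- all the way back to x, which is absurd.  Otherwise y is the parent of x;
-- the last step w → x cannot also come from the parent of x (w ≠ y), so it
-- leads towards the root, and then the rank falls all the way back to x.

module ParentForest {V : Set} (E : V → V → Set) (Parent : V → V → Set)
  (rank : V → ℕ)
  (parent-rank   : ∀ {a b} → Parent a b → rank a < rank b)
  (parent-unique : ∀ {a a' b} → Parent a b → Parent a' b → a ≡ a')
  (edge-oriented : ∀ {a b} → E a b → Parent a b ⊎ Parent b a) where

  NonBacktracking : List V → Set
  NonBacktracking (a ∷ b ∷ c ∷ xs) = a ≢ c × NonBacktracking (b ∷ c ∷ xs)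
  NonBacktracking _ = ⊤

  end : V → List V → V
  end x []       = x
  end x (y ∷ ys) = end y ys

  FinalStep : (V → V → Set) → V → List V → Set
  FinalStep R x []           = ⊥
  FinalStep R x (y ∷ [])     = R x y
  FinalStep R x (y ∷ z ∷ zs) = FinalStep R y (z ∷ zs)

  ascent-continues : ∀ a b ws → Chain E (a ∷ b ∷ ws)
    → NonBacktracking (a ∷ b ∷ ws) → Parent a b
    → rank a < rank (end b ws) × FinalStep Parent a (b ∷ ws)
  ascent-continues a b [] _ _ p = parent-rank p , p
  ascent-continues a b (c ∷ ws) (_ , ch) (a≢c , nb) p with edge-oriented (proj₁ ch)
  ... | inj₂ c-parent-of-b = ⊥-elim (a≢c (parent-unique p c-parent-of-b))
  ... | inj₁ b-parent-of-c =
    let lt , final = ascent-continues b c ws ch nb b-parent-of-c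
    in  <-trans (parent-rank p) lt , final

  final-not-both-ways : ∀ x ys → FinalStep Parent x ys → FinalStep (flip Parent) x ys → ⊥
  final-not-both-ways x (y ∷ [])     p q = <-asym (parent-rank p) (parent-rank q)
  final-not-both-ways x (y ∷ z ∷ zs) p q = final-not-both-ways y (z ∷ zs) p q

  final-oriented : ∀ a b bs → Chain E (a ∷ b ∷ bs)
    → FinalStep Parent a (b ∷ bs) ⊎ FinalStep (flip Parent) a (b ∷ bs)
  final-oriented a b []       (e , _)  = edge-oriented e
  final-oriented a b (c ∷ bs) (_ , ch) = final-oriented b c bs ch

  descent-throughout : ∀ a b ws → Chain E (a ∷ b ∷ ws)
    → NonBacktracking (a ∷ b ∷ ws) → FinalStep (flip Parent) a (b ∷ ws)
    → rank (end b ws) < rank a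
  descent-throughout a b [] _ _ q = parent-rank q
  descent-throughout a b (c ∷ ws) (e , ch) (a≢c , nb) final with edge-oriented e
  ... | inj₂ b-parent-of-a = <-trans (descent-throughout b c ws ch nb final) (parent-rank b-parent-of-a)
  ... | inj₁ a-parent-of-b = ⊥-elim (final-not-both-ways b (c ∷ ws)
          (proj₂ (ascent-continues a b (c ∷ ws) (e , ch) (a≢c , nb) a-parent-of-b)) final)

  end-snoc : ∀ a ys x → end a (ys ++ [ x ]) ≡ x
  end-snoc a []       x = refl
  end-snoc a (y ∷ ys) x = end-snoc y ys x

  final-snoc : ∀ {R} a ys x → FinalStep R a (ys ++ [ x ]) → R (end a ys) x
  final-snoc a []           x r = r
  final-snoc a (y ∷ [])     x r = r
  final-snoc a (y ∷ z ∷ zs) x r = final-snoc y (z ∷ zs) x r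

  end-satisfies : ∀ {Q : V → Set} z rest → All Q (z ∷ rest) → Q (end z rest)
  end-satisfies z []         (q ∷ _)  = q
  end-satisfies z (y ∷ rest) (_ ∷ qs) = end-satisfies y rest qs

  unique⇒nonBacktracking : ∀ ws → Unique ws → NonBacktracking ws
  unique⇒nonBacktracking (a ∷ b ∷ c ∷ xs) ((_ ∷ a≢c ∷ _) ∷ u) =
    a≢c , unique⇒nonBacktracking (b ∷ c ∷ xs) u
  unique⇒nonBacktracking (a ∷ b ∷ []) _ = tt
  unique⇒nonBacktracking (a ∷ [])     _ = tt
  unique⇒nonBacktracking []           _ = tt

  nonBacktracking-snoc : ∀ ws x → NonBacktracking ws → All (_≢ x) ws
                       → NonBacktracking (ws ++ [ x ])
  nonBacktracking-snoc (a ∷ b ∷ c ∷ ws) x (a≢c , nb) (_ ∷ ws≢x) =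
    a≢c , nonBacktracking-snoc (b ∷ c ∷ ws) x nb ws≢x
  nonBacktracking-snoc (a ∷ b ∷ []) x _ (a≢x ∷ _) = a≢x , tt
  nonBacktracking-snoc (a ∷ [])     x _ _         = tt
  nonBacktracking-snoc []           x _ _         = tt

  acyclic : ∀ cs → ¬ IsCycle E cs
  acyclic (x ∷ y ∷ z ∷ rest) ((x≢ ∷ y≢ ∷ uz) , (e , ch)) =
    first-step (edge-oriented e)
    where
      closed : NonBacktracking (x ∷ y ∷ z ∷ (rest ++ [ x ]))
      closed = All.lookup x≢ (there (here refl))
             , nonBacktracking-snoc (y ∷ z ∷ rest) x
                 (unique⇒nonBacktracking (y ∷ z ∷ rest) (y≢ ∷ uz))
                 (All.map (λ x≢w w≡x → x≢w (sym w≡x)) x≢)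
      first-step : Parent x y ⊎ Parent y x → ⊥
      first-step (inj₁ x-parent-of-y) =
        <-irrefl refl (subst (λ w → rank x < rank w) (end-snoc z rest x)
          (proj₁ (ascent-continues x y (z ∷ rest ++ [ x ]) (e , ch) closed x-parent-of-y)))
      first-step (inj₂ y-parent-of-x) with final-oriented x y (z ∷ rest ++ [ x ]) (e , ch)
      ... | inj₁ away    = end-satisfies z rest y≢
                             (parent-unique y-parent-of-x (final-snoc y (z ∷ rest) x away))
      ... | inj₂ towards = <-irrefl refl (subst (λ w → rank w < rank x) (end-snoc z rest x)
                             (descent-throughout x y (z ∷ rest ++ [ x ]) (e , ch) closed towards))

centre : ℕ → ℕ
centre n = n ∸ n / 2

centre≤n : ∀ n → centre n ≤ n
centre≤n n = m∸n≤m n (n / 2)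

centre-positive : ∀ {n} → 1 ≤ n → 1 ≤ centre n
centre-positive {suc k} _ = m<n⇒0<n∸m (m/n<m (suc k) 2 (s≤s (s≤s z≤n)))

centre-from-top : ∀ n → n ∸ centre n ≡ n / 2
centre-from-top n = m∸[m∸n]≡n (m/n≤m n 2)

-- the bottom end 1 is at most ⌊n/2⌋ steps below the centre, as n ≤ 2⌊n/2⌋ + 1
centre-from-bottom : ∀ n → centre n ∸ 1 ≤ n / 2
centre-from-bottom n =
  m≤n+o⇒m∸n≤o (centre n) 1 (m≤n+o⇒m∸n≤o n (n / 2) n≤2⌊n/2⌋+1)
  where
    open ≤-Reasoning
    double-plus-one : ∀ q → 1 + q * 2 ≡ q + suc q
    double-plus-one = solve-∀
    n≤2⌊n/2⌋+1 : n ≤ n / 2 + suc (n / 2)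
    n≤2⌊n/2⌋+1 = begin
      n                 ≡⟨ m≡m%n+[m/n]*n n 2 ⟩
      n % 2 + n / 2 * 2 ≤⟨ +-monoˡ-≤ (n / 2 * 2) (s≤s⁻¹ (m%n<n n 2)) ⟩
      1 + n / 2 * 2     ≡⟨ double-plus-one (n / 2) ⟩
      n / 2 + suc (n / 2) ∎

-- PathParent c a b : a is the neighbour of b on the way from b to c
PathParent : ℕ → ℕ → ℕ → Set
PathParent c a b = (suc a ≡ b × c ≤ a) ⊎ (a ≡ suc b × a ≤ c)

pathParent-rank : ∀ {c a b} → PathParent c a b → ∣ a - c ∣ < ∣ b - c ∣
pathParent-rank {c} {a} (inj₁ (refl , c≤a)) = begin-strict
  ∣ a - c ∣     ≡⟨ m≤n⇒∣n-m∣≡n∸m c≤a ⟩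
  a ∸ c         <⟨ n<1+n (a ∸ c) ⟩
  suc (a ∸ c)   ≡⟨ +-∸-assoc 1 c≤a ⟨
  suc a ∸ c     ≡⟨ m≤n⇒∣n-m∣≡n∸m (m≤n⇒m≤1+n c≤a) ⟨
  ∣ suc a - c ∣ ∎
  where open ≤-Reasoning
pathParent-rank {c} {_} {b} (inj₂ (refl , 1+b≤c)) = begin-strict
  ∣ suc b - c ∣ ≡⟨ m≤n⇒∣m-n∣≡n∸m 1+b≤c ⟩
  c ∸ suc b     <⟨ ∸-monoʳ-< (n<1+n b) 1+b≤c ⟩
  c ∸ b         ≡⟨ m≤n⇒∣m-n∣≡n∸m (<⇒≤ 1+b≤c) ⟨
  ∣ b - c ∣     ∎
  where open ≤-Reasoning

pathParent-unique : ∀ {c a a' b} → PathParent c a b → PathParent c a' b → a ≡ a'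
pathParent-unique (inj₁ (p , _)) (inj₁ (q , _)) = suc-injective (trans p (sym q))
pathParent-unique (inj₂ (p , _)) (inj₂ (q , _)) = trans p (sym q)
pathParent-unique (inj₁ (refl , c≤a)) (inj₂ (refl , a'≤c)) =
  ⊥-elim (<-irrefl refl (≤-trans a'≤c (m≤n⇒m≤1+n c≤a)))
pathParent-unique (inj₂ (refl , a≤c)) (inj₁ (refl , c≤a')) =
  ⊥-elim (<-irrefl refl (≤-trans a≤c (m≤n⇒m≤1+n c≤a')))

centre-has-no-parent : ∀ {c a} → ¬ PathParent c a c
centre-has-no-parent (inj₁ (refl , c≤a)) = <-irrefl refl c≤a
centre-has-no-parent (inj₂ (refl , a≤c)) = <-irrefl refl a≤c

pathParent-adj : ∀ {c a b} → PathParent c a b → PathAdj a b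
pathParent-adj (inj₁ (p , _)) = inj₁ p
pathParent-adj (inj₂ (p , _)) = inj₂ (sym p)

adj-oriented : ∀ c {a b} → PathAdj a b → PathParent c a b ⊎ PathParent c b a
adj-oriented c {a} (inj₁ 1+a≡b) with c ≤? a
... | yes c≤a = inj₁ (inj₁ (1+a≡b , c≤a))
... | no  c≰a = inj₂ (inj₂ (sym 1+a≡b , subst (_≤ c) 1+a≡b (≰⇒> c≰a)))
adj-oriented c {a} {b} (inj₂ 1+b≡a) = swap (adj-oriented c {b} {a} (inj₁ 1+b≡a))

PathTreeEdge : ℕ → ℕ → ℕ → Set
PathTreeEdge n a b =
  (1 ≤ a × a ≤ n) × (1 ≤ b × b ≤ n) × (PathParent (centre n) a b ⊎ PathParent (centre n) b a)

ascend : ∀ {n} k {a} → 1 ≤ a → a + k ≡ centre n → Walk (PathTreeEdge n) k a (centre n)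
ascend zero {a} _ a+0≡c = subst (Walk _ 0 a) (trans (sym (+-identityʳ a)) a+0≡c) here
ascend {n} (suc k) {a} 1≤a a+1+k≡c = step edge (ascend k (s≤s z≤n) 1+a+k≡c)
  where
    1+a+k≡c : suc a + k ≡ centre n
    1+a+k≡c = trans (sym (+-suc a k)) a+1+k≡c
    1+a≤c : suc a ≤ centre n
    1+a≤c = ≤-trans (m≤m+n (suc a) k) (≤-reflexive 1+a+k≡c)
    edge : PathTreeEdge n a (suc a)
    edge = (1≤a , ≤-trans (<⇒≤ 1+a≤c) (centre≤n n))
         , (s≤s z≤n , ≤-trans 1+a≤c (centre≤n n))
         , inj₂ (inj₂ (refl , 1+a≤c))

descend : ∀ {n} → 1 ≤ centre n → ∀ k → k + centre n ≤ n
        → Walk (PathTreeEdge n) k (k + centre n) (centre n)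
descend 1≤c zero    _  = here
descend {n} 1≤c (suc k) le = step edge (descend 1≤c k k+c≤n)
  where
    k+c≤n : k + centre n ≤ n
    k+c≤n = ≤-trans (n≤1+n _) le
    c≤k+c : centre n ≤ k + centre n
    c≤k+c = m≤n+m (centre n) k
    edge : PathTreeEdge n (suc k + centre n) (k + centre n)
    edge = (s≤s z≤n , le) , (≤-trans 1≤c c≤k+c , k+c≤n) , inj₂ (inj₁ (refl , c≤k+c))

toCentre : ∀ {n a} → 1 ≤ a → a ≤ n → ∃[ l ] (l ≤ n / 2 × Walk (PathTreeEdge n) l a (centre n))
toCentre {n} {a} 1≤a a≤n with ≤-total a (centre n)
... | inj₁ a≤c = centre n ∸ a
               , ≤-trans (∸-monoʳ-≤ (centre n) 1≤a) (centre-from-bottom n)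
               , ascend (centre n ∸ a) 1≤a (m+[n∸m]≡n a≤c)
... | inj₂ c≤a = a ∸ centre n
               , ≤-trans (∸-monoˡ-≤ (centre n) a≤n) (≤-reflexive (centre-from-top n))
               , subst (λ x → Walk (PathTreeEdge n) (a ∸ centre n) x (centre n)) (m∸n+n≡m c≤a)
                   (descend (centre-positive (≤-trans 1≤a a≤n)) (a ∸ centre n)
                     (subst (_≤ n) (sym (m∸n+n≡m c≤a)) a≤n))

-- Parent ns u v says that u is the parent of v.

Parent : ∀ {d} → Vec ℕ d → Vertex d → Vertex d → Set
Parent []       []       []       = ⊥
Parent (n ∷ ns) (a ∷ as) (b ∷ bs) =
  (as ≡ bs × PathParent (centre n) a b) ⊎ (a ≡ centre n × b ≡ centre n × Parent ns as bs)

rank : ∀ {d} → Vec ℕ d → Vertex d → ℕ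
rank []       []       = 0
rank (n ∷ ns) (a ∷ as) = ∣ a - centre n ∣ + rank ns as

TreeEdge : ∀ {d} → Vec ℕ d → Vertex d → Vertex d → Set
TreeEdge ns u v = InGrid ns u × InGrid ns v × (Parent ns u v ⊎ Parent ns v u)

parent-rank : ∀ {d} (ns : Vec ℕ d) {u v} → Parent ns u v → rank ns u < rank ns v
parent-rank [] {[]} {[]} ()
parent-rank (n ∷ ns) {a ∷ as} {b ∷ bs} (inj₁ (refl , p)) = +-monoˡ-< (rank ns as) (pathParent-rank p)
parent-rank (n ∷ ns) {a ∷ as} {b ∷ bs} (inj₂ (refl , refl , p)) =
  +-monoʳ-< ∣ centre n - centre n ∣ (parent-rank ns p)

parent-unique : ∀ {d} (ns : Vec ℕ d) {u u' v} → Parent ns u v → Parent ns u' v → u ≡ u'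
parent-unique [] {[]} {[]} {[]} ()
parent-unique (n ∷ ns) {a ∷ as} {a' ∷ as'} {b ∷ bs} (inj₁ (p , q)) (inj₁ (p' , q')) =
  cong₂ _∷_ (pathParent-unique q q') (trans p (sym p'))
parent-unique (n ∷ ns) {a ∷ as} {a' ∷ as'} {b ∷ bs} (inj₂ (p , _ , r)) (inj₂ (p' , _ , r')) =
  cong₂ _∷_ (trans p (sym p')) (parent-unique ns r r')
parent-unique (n ∷ ns) {_ ∷ _} {_ ∷ _} {_ ∷ _} (inj₁ (_ , q)) (inj₂ (_ , refl , _)) =
  ⊥-elim (centre-has-no-parent q)
parent-unique (n ∷ ns) {_ ∷ _} {_ ∷ _} {_ ∷ _} (inj₂ (_ , refl , _)) (inj₁ (_ , q)) =
  ⊥-elim (centre-has-no-parent q)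

parent-diffOne : ∀ {d} (ns : Vec ℕ d) {u v} → Parent ns u v → DiffOne u v
parent-diffOne [] {[]} {[]} ()
parent-diffOne (n ∷ ns) {a ∷ as} {b ∷ bs} (inj₁ (eq , p)) = inj₁ (pathParent-adj p , eq)
parent-diffOne (n ∷ ns) {a ∷ as} {b ∷ bs} (inj₂ (refl , refl , p)) = inj₂ (refl , parent-diffOne ns p)

diffOne-sym : ∀ {d} {u v : Vertex d} → DiffOne u v → DiffOne v u
diffOne-sym {u = []} {[]} ()
diffOne-sym {u = _ ∷ _} {_ ∷ _} (inj₁ (inj₁ p , eq)) = inj₁ (inj₂ p , sym eq)
diffOne-sym {u = _ ∷ _} {_ ∷ _} (inj₁ (inj₂ p , eq)) = inj₁ (inj₁ p , sym eq)
diffOne-sym {u = _ ∷ _} {_ ∷ _} (inj₂ (eq , df))     = inj₂ (sym eq , diffOne-sym df)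

treeEdge-sym : ∀ {d} {ns : Vec ℕ d} {u v} → TreeEdge ns u v → TreeEdge ns v u
treeEdge-sym (gu , gv , p) = gv , gu , swap p

treeEdge-grid : ∀ {d} {ns : Vec ℕ d} {u v} → TreeEdge ns u v → GridAdj ns u v
treeEdge-grid {ns = ns} (gu , gv , inj₁ p) = gu , gv , parent-diffOne ns p
treeEdge-grid {ns = ns} (gu , gv , inj₂ p) = gu , gv , diffOne-sym (parent-diffOne ns p)

alongFirst : ∀ {d n} {ns : Vec ℕ d} {as} → InGrid ns as
           → ∀ {a b} → PathTreeEdge n a b → TreeEdge (n ∷ ns) (a ∷ as) (b ∷ as)
alongFirst g (ra , rb , p) =
  (ra , g) , (rb , g) , ⊎-map (λ q → inj₁ (refl , q)) (λ q → inj₁ (refl , q)) p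

throughCentre : ∀ {d n} {ns : Vec ℕ d} → 1 ≤ centre n → centre n ≤ n
              → ∀ {as bs} → TreeEdge ns as bs → TreeEdge (n ∷ ns) (centre n ∷ as) (centre n ∷ bs)
throughCentre lo hi (ga , gb , p) =
  ((lo , hi) , ga) , ((lo , hi) , gb)
  , ⊎-map (λ q → inj₂ (refl , refl , q)) (λ q → inj₂ (refl , refl , q)) p

lineToCentre : ∀ {d n} {ns : Vec ℕ d} {a as} → InGrid (n ∷ ns) (a ∷ as)
             → ∃[ l ] (l ≤ n / 2 × Walk (TreeEdge (n ∷ ns)) l (a ∷ as) (centre n ∷ as))
lineToCentre {as = as} ((1≤a , a≤n) , g) =
  let l , l≤ , w = toCentre 1≤a a≤n in l , l≤ , mapʷ (_∷ as) (alongFirst g) w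

inGrid-centre : ∀ {d n} {ns : Vec ℕ d} {a as} → InGrid (n ∷ ns) (a ∷ as) → 1 ≤ centre n
inGrid-centre ((1≤a , a≤n) , _) = centre-positive (≤-trans 1≤a a≤n)

toRoot : ∀ {d} (ns : Vec ℕ d) u → InGrid ns u → ∃[ k ] Walk (TreeEdge ns) k u (map centre ns)
toRoot []       []       _  = 0 , here
toRoot (n ∷ ns) (a ∷ as) gu with lineToCentre gu | toRoot ns as (proj₂ gu)
... | l , _ , w₁ | k , w₂ =
  l + k , w₁ ++ʷ mapʷ (centre n ∷_) (throughCentre (inGrid-centre gu) (centre≤n n)) w₂

spanningTree : ∀ {d} (ns : Vec ℕ d) → IsSpanningTree ns (TreeEdge ns)
spanningTree ns = record
  { subgraph  = λ _ _ → treeEdge-grid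
  ; symmetric = λ _ _ → treeEdge-sym
  ; connected = connected
  ; acyclic   = ParentForest.acyclic (TreeEdge ns) (Parent ns) (rank ns)
                  (parent-rank ns) (parent-unique ns) (λ e → proj₂ (proj₂ e))
  }
  where
    connected : ∀ u v → InGrid ns u → InGrid ns v → ∃[ k ] Walk (TreeEdge ns) k u v
    connected u v gu gv with toRoot ns u gu | toRoot ns v gv
    ... | k , w | m , w' = k + m , w ++ʷ reverseʷ treeEdge-sym w'

edge-distance : ∀ {d} {T : Vertex d → Vertex d → Set} {u v k} → 1 ≤ k → T u v → DistLe T u v k
edge-distance 1≤k e = 1 , 1≤k , step e here

firstCoordinateEdge : ∀ {d n} {ns : Vec ℕ d} {a b as}
  → InGrid (n ∷ ns) (a ∷ as) → InGrid (n ∷ ns) (b ∷ as) → PathAdj a b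
  → TreeEdge (n ∷ ns) (a ∷ as) (b ∷ as)
firstCoordinateEdge {n = n} (ra , g) (rb , _) adj = alongFirst g (ra , rb , adj-oriented (centre n) adj)

detour : ∀ {d n k} {ns : Vec ℕ d} {a as bs}
  → InGrid (n ∷ ns) (a ∷ as) → InGrid (n ∷ ns) (a ∷ bs) → DistLe (TreeEdge ns) as bs k
  → DistLe (TreeEdge (n ∷ ns)) (a ∷ as) (a ∷ bs) (n / 2 + (k + n / 2))
detour {n = n} {ns = ns} {as = as} {bs} gu gv (m , m≤k , w) with lineToCentre gu | lineToCentre gv
... | l , l≤ , w₁ | l' , l'≤ , w₂ =
  l + (m + l') , +-mono-≤ l≤ (+-mono-≤ m≤k l'≤) , w₁ ++ʷ (across ++ʷ reverseʷ treeEdge-sym w₂)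
  where
    across : Walk (TreeEdge (n ∷ ns)) m (centre n ∷ as) (centre n ∷ bs)
    across = mapʷ (centre n ∷_) (throughCentre (inGrid-centre gu) (centre≤n n)) w

stretch : ∀ {d} (ns : Vec ℕ (suc d))
        → StretchLe ns (TreeEdge ns) (2 * sum (map (λ m → m / 2) (init ns)) + 1)
stretch {zero} (n ∷ []) (a ∷ []) (b ∷ []) (gu , gv , inj₁ (adj , refl)) =
  edge-distance ≤-refl (firstCoordinateEdge gu gv adj)
stretch {suc d} (n ∷ ns) (a ∷ as) (b ∷ bs) (gu , gv , inj₁ (adj , refl)) =
  edge-distance (m≤n+m 1 _) (firstCoordinateEdge gu gv adj)
stretch {suc d} (n ∷ ns) (a ∷ as) (b ∷ bs) (gu , gv , inj₂ (refl , df)) =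
  subst (DistLe (TreeEdge (n ∷ ns)) (a ∷ as) (a ∷ bs))
        (bound-step (n / 2) (sum (map (λ m → m / 2) (init ns))))
        (detour gu gv (stretch ns as bs (proj₂ gu , proj₂ gv , df)))
  where
    bound-step : ∀ x s → x + ((2 * s + 1) + x) ≡ 2 * (x + s) + 1
    bound-step = solve-∀

-- The theorem: the tree above witnesses the bound.  It does not need the
-- hypotheses 2 ≤ n_i and n_1 ≤ ... ≤ n_d.
lemma4p1 : (d : ℕ) (ns : Vec ℕ (suc d))
    → (∀ i → 2 ≤ lookup ns i)
    → (∀ i j → i ≤ᶠ j → lookup ns i ≤ lookup ns j)
    → TreeStretchLe ns (2 * sum (map (λ m → m / 2) (init ns)) + 1)
lemma4p1 d ns _ _ = TreeEdge ns , spanningTree ns , stretch ns
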